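{- Let $f(x)\in\mathbb{Z}[x]$ have degree $d\ge2$ and let $t\in\mathbb{Z}$ be a wandering point for $f$. If $n\in S(f,t)$, then $1/n$ is $(f,t,1)$-accessible.
   Context: $\operatorname{Orb}_f(t)=\{f^n(t):n\ge0\}$ ($f^0(x)=x$, $f^n=f\circ f^{n-1}$); $t$ is wandering if this set is infinite. For an integer sequence $(a_n)_{n\ge1}$, an integer $u\ge2$ is a primitive divisor of $a_m$ if $u\mid a_m$ and $u\nmid a_s$ for all $1\le s<m$. $S(f,t)=\{n\ge1: f^n(t)-t \text{ has a primitive divisor}\}$ (with respect to the sequence $(f^n(t)-t)_{n\ge1}$). For $A\subseteq\mathbb{Z}$, $$\delta_{f,t}(A)=\lim_{X\to\infty}\frac{|\{x\in A\cap \operatorname{Orb}_f(t): x\le X\}|}{|\{x\in\operatorname{Orb}_f(t): x\le X\}|},$$ provided this limit exists. A real number $\delta\in[0,1]$ is $(f,t,k)$-accessible if there is a system $\{t+n_s\mathbb{Z}\}_{s=1}^k$ with positive integers $n_s$ such that $\delta_{f,t}\left(\bigcup_{s=1}^k(t+n_s\mathbb{Z})\right)=\delta$. -}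

module Defs where

open import Data.Nat as ℕ using (ℕ; zero; suc)
open import Data.Integer as ℤ using (ℤ; +_; ∣_∣)
open import Data.Integer.Divisibility using (_∣_)
import Data.Nat.Divisibility as ℕD
open import Data.Rational as ℚ using (ℚ)
open import Data.List using (List; []; _∷_; _++_; [_]; length; map; filter; upTo; deduplicate)
open import Data.List.Membership.Propositional using (_∈_)
open import Data.Fin using (Fin)
open import Data.Fin.Properties using (any?)
open import Data.Product using (Σ; ∃; _×_; _,_)
open import Relation.Nullary using (¬_; Dec; yes)
open import Data.Unit using (⊤; tt)
open import Level using (0ℓ)
open import Relation.Unary using (Pred; Decidable)
open import Relation.Binary.PropositionalEquality using (_≡_; _≢_)

-- Integer polynomials as coefficient lists, lowest degree first:
-- a₀ ∷ a₁ ∷ … ∷ a_d ∷ []  represents  a₀ + a₁ x + … + a_d x^d.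
Poly : Set
Poly = List ℤ

eval : Poly → ℤ → ℤ
eval []       x = ℤ.0ℤ
eval (a ∷ as) x = a ℤ.+ x ℤ.* eval as x

HasDegree : Poly → ℕ → Set
HasDegree f d = Σ Poly λ q → Σ ℤ λ a → (f ≡ q ++ [ a ]) × (a ≢ ℤ.0ℤ) × (length q ≡ d)

iter : Poly → ℕ → ℤ → ℤ
iter f zero    t = t
iter f (suc n) t = eval f (iter f n t)

InOrb : Poly → ℤ → ℤ → Set
InOrb f t x = ∃ λ n → iter f n t ≡ x

-- t is wandering: the orbit is infinite, i.e. not contained in any finite list
Wandering : Poly → ℤ → Set
Wandering f t = (L : List ℤ) → ∃ λ n → ¬ (iter f n t ∈ L)

orbSeq : Poly → ℤ → ℕ → ℤ
orbSeq f t n = iter f n t ℤ.- t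

PrimitiveDivisor : (ℕ → ℤ) → ℤ → ℕ → Set
PrimitiveDivisor a u m =
  (+ 2 ℤ.≤ u) × (u ∣ a m) × ((s : ℕ) → 1 ℕ.≤ s → s ℕ.< m → ¬ (u ∣ a s))

InS : Poly → ℤ → ℕ → Set
InS f t n = (1 ℕ.≤ n) × (∃ λ u → PrimitiveDivisor (orbSeq f t) u n)

-- N is a cutoff for X: every orbit element f^m(t) with m ≥ N has |f^m(t)| > X.
-- Then {x ∈ Orb : |x| ≤ X} = {f^m(t) : m < N, |f^m(t)| ≤ X}.
Cutoff : Poly → ℤ → ℕ → ℕ → Set
Cutoff f t X N = (m : ℕ) → N ℕ.≤ m → X ℕ.< ∣ iter f m t ∣

orbBelow : Poly → ℤ → (P : Pred ℤ 0ℓ) → Decidable P → ℕ → ℕ → List ℤ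
orbBelow f t P P? X N =
  deduplicate ℤ._≟_
    (filter P? (filter (λ x → ∣ x ∣ ℕ.≤? X) (map (λ m → iter f m t) (upTo N))))

Univ : Pred ℤ 0ℓ
Univ _ = ⊤

Univ? : Decidable Univ
Univ? _ = yes tt

DensityIs : Poly → ℤ → (A : Pred ℤ 0ℓ) → Decidable A → ℚ → Set
DensityIs f t A A? δ =
  (ε : ℚ) → ℚ.Positive ε → ∃ λ X₀ → (X : ℕ) → X₀ ℕ.≤ X →
    Σ ℕ λ N → Cutoff f t X N × Σ ℕ λ k →
      (length (orbBelow f t Univ Univ? X N) ≡ suc k) ×
      (ℚ.∣ ((+ length (orbBelow f t A A? X N)) ℚ./ suc k) ℚ.- δ ∣ ℚ.< ε)

InUnionAP : ℤ → {k : ℕ} → (Fin k → ℕ) → Pred ℤ 0ℓ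
InUnionAP t ns x = ∃ λ s → (+ ns s) ∣ (x ℤ.- t)

InUnionAP? : (t : ℤ) → {k : ℕ} → (ns : Fin k → ℕ) → Decidable (InUnionAP t ns)
InUnionAP? t ns x = any? (λ s → ∣ + ns s ∣ ℕD.∣? ∣ x ℤ.- t ∣)

Accessible : Poly → ℤ → ℕ → ℚ → Set
Accessible f t k δ =
  Σ (Fin k → ℕ) λ ns → ((s : Fin k) → 1 ℕ.≤ ns s) ×
    DensityIs f t (InUnionAP t ns) (InUnionAP? t ns) δ

-- 1/n as a rational (n ≥ 1 in all uses; 1/0 is set to 0 by convention)
recip : ℕ → ℚ
recip zero    = ℚ.0ℚ
recip (suc m) = (+ 1) ℚ./ suc m

-- Let u be a primitive divisor of f^n(t) − t. As f has integer coefficients, x ≡ y (mod u) implies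
-- f(x) ≡ f(y) (mod u), so f^m(t) ≡ t (mod u) exactly when n ∣ m: writing m = qn + r, primitivity
-- rules out 0 < r < n. Thus the orbit points lying in t + uℤ are those with index divisible by n.
-- Since deg f ≥ 2, |f(x)| > |x| outside a bounded set, so a wandering orbit eventually grows
-- strictly in absolute value: its points are pairwise distinct, and those with |x| ≤ X are exactly
-- the f^m(t) with m below a cutoff M that tends to infinity with X. Among the indices m < M the
-- proportion of multiples of n is ⌈M/n⌉/M, which tends to 1/n.
module Submission where

open import Defs
open import Data.Nat using (ℕ; _≤_)
open import Data.Integer using (ℤ)

open import Data.Nat as ℕ using (zero; suc; z≤n; s≤s; _<_; _∸_; NonZero)
import Data.Nat.Properties as ℕP
import Data.Nat.Divisibility as ℕD
open import Data.Nat.DivMod using (_%_; _/_; m≡m%n+[m/n]*n; m%n<n)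
import Data.Nat.Tactic.RingSolver as ℕSolver
open import Data.Integer as ℤ using (+_; -[1+_]; +[1+_]; ∣_∣)
import Data.Integer.Properties as ℤP
open import Data.Integer.Divisibility using (_∣_)
open import Data.Integer.Divisibility.Signed as ℤD using (∣ᵤ⇒∣; ∣⇒∣ᵤ)
open import Data.Integer.Tactic.RingSolver using (solve-∀)
open import Data.List using (List; []; _∷_; _++_; [_]; map; filter; upTo; length; deduplicate)
open import Data.Rational as ℚ using (ℚ; mkℚ)
import Data.Rational.Properties as ℚP
open import Data.Rational.Unnormalised as ℚᵘ using (ℚᵘ; mkℚᵘ; *≤*; *<*)
import Data.Rational.Unnormalised.Properties as ℚᵘP
open import Data.Product using (Σ; ∃; _×_; _,_; proj₁; proj₂)
open import Data.Empty using (⊥-elim)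
import Data.Fin as Fin
open import Data.List.Extrema.Nat using (argmax; f[xs]≤f[argmax])
open import Data.List.Relation.Unary.All as All using (All; []; _∷_)
import Data.List.Properties as LP
open import Data.List.Membership.Propositional using (_∈_)
open import Data.List.Membership.Propositional.Properties using (∈-map⁺; ∈-map⁻; ∈-++⁺ˡ; ∈-++⁺ʳ; ∈-upTo⁺; ∈-upTo⁻)
open import Data.List.Relation.Unary.Unique.Propositional using (Unique; []; _∷_)
import Data.List.Relation.Unary.Unique.Propositional.Properties as UP
open import Data.Sum using (inj₁; inj₂)
open import Function using (_∘_)
open import Function.Bundles using (_⇔_; mk⇔; Equivalence)
open import Level using (0ℓ)
open import Relation.Binary.Definitions using (DecidableEquality; tri<; tri≈; tri>)
open import Relation.Unary using (Pred; Decidable)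
open import Relation.Nullary using (¬_; ¬?; yes; no)
open import Relation.Binary.PropositionalEquality hiding ([_])

-- A record rather than an abbreviation, so that a, b and u can be inferred by unification.
infix 4 _≡_mod_
record _≡_mod_ (a b u : ℤ) : Set where
  constructor ∣⇒≡mod
  field ≡mod⇒∣ : u ℤD.∣ a ℤ.- b
open _≡_mod_

≡mod-refl : ∀ {u} a → a ≡ a mod u
≡mod-refl {u} a = ∣⇒≡mod (ℤD.divides ℤ.0ℤ (trans (ℤP.+-inverseʳ a) (sym (ℤP.*-zeroˡ u))))

≡mod-sym : ∀ {u a b} → a ≡ b mod u → b ≡ a mod u
≡mod-sym {u} {a} {b} (∣⇒≡mod a≡b) = ∣⇒≡mod (subst (u ℤD.∣_) (negate a b) (ℤD.∣m⇒∣-m a≡b))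
  where
  negate : ∀ a b → ℤ.- (a ℤ.- b) ≡ b ℤ.- a
  negate = solve-∀

≡mod-trans : ∀ {u a b c} → a ≡ b mod u → b ≡ c mod u → a ≡ c mod u
≡mod-trans {u} {a} {b} {c} (∣⇒≡mod a≡b) (∣⇒≡mod b≡c) =
  ∣⇒≡mod (subst (u ℤD.∣_) (telescope a b c) (ℤD.∣m∣n⇒∣m+n a≡b b≡c))
  where
  telescope : ∀ a b c → (a ℤ.- b) ℤ.+ (b ℤ.- c) ≡ a ℤ.- c
  telescope = solve-∀

eval-cong-mod : ∀ {u x y} p → x ≡ y mod u → eval p x ≡ eval p y mod u
eval-cong-mod [] _ = ≡mod-refl ℤ.0ℤ
eval-cong-mod {u} {x} {y} (c ∷ p) x≡y = ∣⇒≡mod (subst (u ℤD.∣_) (horner c x y (eval p x) (eval p y))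
  (ℤD.∣m∣n⇒∣m+n (ℤD.∣n⇒∣m*n x (≡mod⇒∣ (eval-cong-mod p x≡y))) (ℤD.∣m⇒∣m*n (eval p y) (≡mod⇒∣ x≡y))))
  where
  horner : ∀ c x y v w → x ℤ.* (v ℤ.- w) ℤ.+ (x ℤ.- y) ℤ.* w ≡ (c ℤ.+ x ℤ.* v) ℤ.- (c ℤ.+ y ℤ.* w)
  horner = solve-∀

iter-+ : ∀ f m n x → iter f (m ℕ.+ n) x ≡ iter f m (iter f n x)
iter-+ f zero    n x = refl
iter-+ f (suc m) n x = cong (eval f) (iter-+ f m n x)

iter-cong-mod : ∀ {u x y} f m → x ≡ y mod u → iter f m x ≡ iter f m y mod u
iter-cong-mod f zero    x≡y = x≡y
iter-cong-mod f (suc m) x≡y = eval-cong-mod f (iter-cong-mod f m x≡y)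

iter-periodic-mod : ∀ {u} f t n → iter f n t ≡ t mod u →
                    ∀ r q → iter f (r ℕ.+ q ℕ.* n) t ≡ iter f r t mod u
iter-periodic-mod {u} f t n period r zero =
  subst (λ m → iter f m t ≡ iter f r t mod u) (sym (ℕP.+-identityʳ r)) (≡mod-refl (iter f r t))
iter-periodic-mod {u} f t n period r (suc q) =
  subst (λ m → iter f m t ≡ iter f r t mod u) (sym (reassoc r q n))
    (≡mod-trans one-more-period (iter-periodic-mod f t n period r q))
  where
  m : ℕ
  m = r ℕ.+ q ℕ.* n
  reassoc : ∀ r q n → r ℕ.+ suc q ℕ.* n ≡ (r ℕ.+ q ℕ.* n) ℕ.+ n
  reassoc = ℕSolver.solve-∀
  one-more-period : iter f (m ℕ.+ n) t ≡ iter f m t mod u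
  one-more-period = subst (_≡ iter f m t mod u) (sym (iter-+ f m n t)) (iter-cong-mod f m period)

primitiveDivisor-∣⇔∣ : ∀ {f t u n} .{{_ : NonZero n}} → PrimitiveDivisor (orbSeq f t) u n →
                       ∀ m → (u ∣ orbSeq f t m) ⇔ (n ℕD.∣ m)
primitiveDivisor-∣⇔∣ {f} {t} {u} {n} (_ , u∣aₙ , ¬earlier) m = mk⇔ index-divisible orbit-divisible
  where
  period : iter f n t ≡ t mod u
  period = ∣⇒≡mod (∣ᵤ⇒∣ u∣aₙ)

  orbit-divisible : n ℕD.∣ m → u ∣ orbSeq f t m
  orbit-divisible (ℕD.divides q refl) = ∣⇒∣ᵤ (≡mod⇒∣ (iter-periodic-mod f t n period 0 q))

  index-divisible : u ∣ orbSeq f t m → n ℕD.∣ m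
  index-divisible u∣aₘ = remainder-zero (m % n) refl
    where
    q : ℕ
    q = m / n
    m≡r+qn : m ≡ m % n ℕ.+ q ℕ.* n
    m≡r+qn = m≡m%n+[m/n]*n m n
    u∣aᵣ : iter f (m % n) t ≡ t mod u
    u∣aᵣ = ≡mod-trans (≡mod-sym (subst (λ k → iter f k t ≡ iter f (m % n) t mod u) (sym m≡r+qn)
                                    (iter-periodic-mod f t n period (m % n) q)))
                      (∣⇒≡mod (∣ᵤ⇒∣ u∣aₘ))
    remainder-zero : ∀ r → m % n ≡ r → n ℕD.∣ m
    remainder-zero zero    r≡0 = ℕD.divides q (trans m≡r+qn (cong (ℕ._+ q ℕ.* n) r≡0))
    remainder-zero (suc r) r≡s = ⊥-elim (¬earlier (suc r) (s≤s z≤n) (subst (_< n) r≡s (m%n<n m n))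
                                          (∣⇒∣ᵤ (≡mod⇒∣ (subst (λ k → iter f k t ≡ t mod u) r≡s u∣aᵣ))))

EscapeRadius : Poly → ℕ → Set
EscapeRadius f B = ∀ x → B ≤ ∣ x ∣ → ∣ x ∣ < ∣ eval f x ∣

horner-step-≥ : ∀ {C m} c p x → ∣ c ∣ ≤ C → m ≤ ∣ eval p x ∣ → ∣ x ∣ ℕ.* m ≤ ∣ eval (c ∷ p) x ∣ ℕ.+ C
horner-step-≥ {C} {m} c p x ∣c∣≤C m≤∣v∣ = begin
  ∣ x ∣ ℕ.* m                            ≤⟨ ℕP.*-monoʳ-≤ ∣ x ∣ m≤∣v∣ ⟩
  ∣ x ∣ ℕ.* ∣ v ∣                        ≡⟨ ℤP.abs-* x v ⟨
  ∣ x ℤ.* v ∣                            ≡⟨ cong ∣_∣ (add-sub c (x ℤ.* v)) ⟩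
  ∣ (c ℤ.+ x ℤ.* v) ℤ.+ ℤ.- c ∣          ≤⟨ ℤP.∣i+j∣≤∣i∣+∣j∣ (c ℤ.+ x ℤ.* v) (ℤ.- c) ⟩
  ∣ eval (c ∷ p) x ∣ ℕ.+ ∣ ℤ.- c ∣       ≡⟨ cong (∣ eval (c ∷ p) x ∣ ℕ.+_) (ℤP.∣-i∣≡∣i∣ c) ⟩
  ∣ eval (c ∷ p) x ∣ ℕ.+ ∣ c ∣           ≤⟨ ℕP.+-monoʳ-≤ ∣ eval (c ∷ p) x ∣ ∣c∣≤C ⟩
  ∣ eval (c ∷ p) x ∣ ℕ.+ C               ∎
  where
  open ℕP.≤-Reasoning
  v : ℤ
  v = eval p x
  add-sub : ∀ c w → w ≡ (c ℤ.+ w) ℤ.+ ℤ.- c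
  add-sub = solve-∀

eval-leading≢0 : ∀ {a C x} q → a ≢ ℤ.0ℤ → All (λ c → ∣ c ∣ ≤ C) q → C < ∣ x ∣ →
                 1 ≤ ∣ eval (q ++ [ a ]) x ∣
eval-leading≢0 {a} {x = x} [] a≢0 [] _ rewrite ℤP.*-zeroʳ x | ℤP.+-identityʳ a =
  ℕP.n≢0⇒n>0 (λ ∣a∣≡0 → a≢0 (ℤP.∣i∣≡0⇒i≡0 ∣a∣≡0))
eval-leading≢0 {a} {C} {x} (c ∷ q) a≢0 (∣c∣≤C ∷ bounds) C<∣x∣ =
  ℕP.+-cancelʳ-≤ C 1 ∣ eval (c ∷ q ++ [ a ]) x ∣ (begin
    suc C                                ≤⟨ C<∣x∣ ⟩
    ∣ x ∣                                ≡⟨ ℕP.*-identityʳ ∣ x ∣ ⟨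
    ∣ x ∣ ℕ.* 1                          ≤⟨ horner-step-≥ c (q ++ [ a ]) x ∣c∣≤C
                                              (eval-leading≢0 q a≢0 bounds C<∣x∣) ⟩
    ∣ eval (c ∷ q ++ [ a ]) x ∣ ℕ.+ C    ∎)
  where open ℕP.≤-Reasoning

-- Two Horner steps: |c₁ + x(…)| ≥ 2, hence |c₀ + x(c₁ + x(…))| ≥ 2|x| − C ≥ |x| + 2.
eval-expands : ∀ {a C x} c₀ c₁ q → a ≢ ℤ.0ℤ → All (λ c → ∣ c ∣ ≤ C) (c₀ ∷ c₁ ∷ q) →
               2 ℕ.+ C ≤ ∣ x ∣ → ∣ x ∣ < ∣ eval (c₀ ∷ c₁ ∷ q ++ [ a ]) x ∣
eval-expands {a} {C} {x} c₀ c₁ q a≢0 (∣c₀∣≤C ∷ ∣c₁∣≤C ∷ bounds) 2+C≤∣x∣ =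
  ℕP.+-cancelʳ-≤ C (suc ∣ x ∣) v₀ (begin
    suc ∣ x ∣ ℕ.+ C          ≡⟨ ℕP.+-suc ∣ x ∣ C ⟨
    ∣ x ∣ ℕ.+ suc C          ≤⟨ ℕP.+-monoʳ-≤ ∣ x ∣ (ℕP.n≤1+n (suc C)) ⟩
    ∣ x ∣ ℕ.+ (2 ℕ.+ C)      ≤⟨ ℕP.+-monoʳ-≤ ∣ x ∣ 2+C≤∣x∣ ⟩
    ∣ x ∣ ℕ.+ ∣ x ∣          ≡⟨ cong (∣ x ∣ ℕ.+_) (ℕP.+-identityʳ ∣ x ∣) ⟨
    2 ℕ.* ∣ x ∣              ≡⟨ ℕP.*-comm 2 ∣ x ∣ ⟩
    ∣ x ∣ ℕ.* 2              ≤⟨ horner-step-≥ c₀ (c₁ ∷ q ++ [ a ]) x ∣c₀∣≤C 2≤v₁ ⟩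
    v₀ ℕ.+ C                 ∎)
  where
  open ℕP.≤-Reasoning
  v₀ v₁ : ℕ
  v₀ = ∣ eval (c₀ ∷ c₁ ∷ q ++ [ a ]) x ∣
  v₁ = ∣ eval (c₁ ∷ q ++ [ a ]) x ∣
  2≤v₁ : 2 ≤ v₁
  2≤v₁ = ℕP.+-cancelʳ-≤ C 2 v₁ (begin
    2 ℕ.+ C                  ≤⟨ 2+C≤∣x∣ ⟩
    ∣ x ∣                    ≡⟨ ℕP.*-identityʳ ∣ x ∣ ⟨
    ∣ x ∣ ℕ.* 1              ≤⟨ horner-step-≥ c₁ (q ++ [ a ]) x ∣c₁∣≤C
                                  (eval-leading≢0 q a≢0 bounds (ℕP.≤-trans (ℕP.n≤1+n _) 2+C≤∣x∣)) ⟩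
    v₁ ℕ.+ C                 ∎)

degree≥2⇒escapeRadius : ∀ {f d} → HasDegree f d → 2 ≤ d → ∃ (EscapeRadius f)
degree≥2⇒escapeRadius ([] , _ , _ , _ , refl) ()
degree≥2⇒escapeRadius (_ ∷ [] , _ , _ , _ , refl) (s≤s ())
degree≥2⇒escapeRadius (c₀ ∷ c₁ ∷ q , a , refl , a≢0 , _) _ =
  2 ℕ.+ ∣ largest ∣ , λ x → eval-expands {x = x} c₀ c₁ q a≢0 (f[xs]≤f[argmax] ℤ.0ℤ (c₀ ∷ c₁ ∷ q))
  where
  largest : ℤ
  largest = argmax ∣_∣ ℤ.0ℤ (c₀ ∷ c₁ ∷ q)

iter-escapes : ∀ f {B} → EscapeRadius f B → ∀ {x} → B ≤ ∣ x ∣ → ∀ k → k ℕ.+ ∣ x ∣ ≤ ∣ iter f k x ∣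
iter-escapes f escape B≤∣x∣ zero = ℕP.≤-refl
iter-escapes f escape {x} B≤∣x∣ (suc k) =
  ℕP.≤-<-trans ih (escape (iter f k x) (ℕP.≤-trans B≤∣x∣ (ℕP.≤-trans (ℕP.m≤n+m ∣ x ∣ k) ih)))
  where
  ih : k ℕ.+ ∣ x ∣ ≤ ∣ iter f k x ∣
  ih = iter-escapes f escape B≤∣x∣ k

iter-escapes-aperiodic : ∀ f {B} → EscapeRadius f B → ∀ {x} → B ≤ ∣ x ∣ → ∀ d → iter f (suc d) x ≢ x
iter-escapes-aperiodic f escape {x} B≤∣x∣ d returns =
  ℕP.<-irrefl refl (ℕP.<-≤-trans (s≤s (ℕP.m≤n+m ∣ x ∣ d))
                     (subst (λ y → suc d ℕ.+ ∣ x ∣ ≤ ∣ y ∣) returns (iter-escapes f escape B≤∣x∣ (suc d))))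

absBelow : ℕ → List ℤ
absBelow B = map +_ (upTo B) ++ map -[1+_] (upTo B)

∈-absBelow : ∀ {B} z → ∣ z ∣ < B → z ∈ absBelow B
∈-absBelow (+ k)    k<B = ∈-++⁺ˡ (∈-map⁺ +_ (∈-upTo⁺ k<B))
∈-absBelow {B} -[1+ k ] k<B = ∈-++⁺ʳ (map +_ (upTo B)) (∈-map⁺ -[1+_] (∈-upTo⁺ (ℕP.<-trans (ℕP.n<1+n k) k<B)))

first-from : ∀ {P : Pred ℕ 0ℓ} → Decidable P → ∀ i → (∀ j → j < i → ¬ P j) →
             ∀ N → P (N ℕ.+ i) → ∃ λ M → i ≤ M × P M × (∀ j → j < M → ¬ P j)
first-from P? i before zero Pᵢ = i , ℕP.≤-refl , Pᵢ , before
first-from {P} P? i before (suc N) P[1+N+i] with P? i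
... | yes Pᵢ = i , ℕP.≤-refl , Pᵢ , before
... | no ¬Pᵢ with first-from P? (suc i) before′ N (subst P (sym (ℕP.+-suc N i)) P[1+N+i])
  where
  before′ : ∀ j → j < suc i → ¬ P j
  before′ j j<1+i with ℕP.m≤n⇒m<n∨m≡n (ℕP.<⇒≤pred j<1+i)
  ... | inj₁ j<i  = before j j<i
  ... | inj₂ refl = ¬Pᵢ
... | M , 1+i≤M , rest = M , ℕP.≤-trans (ℕP.n≤1+n i) 1+i≤M , rest

deduplicate-unique : ∀ {A : Set} (_≟_ : DecidableEquality A) {xs} → Unique xs → deduplicate _≟_ xs ≡ xs
deduplicate-unique _≟_ {[]} [] = refl
deduplicate-unique _≟_ {x ∷ xs} (x∉xs ∷ unique) =
  cong (x ∷_) (trans (cong (filter (¬? ∘ (x ≟_))) (deduplicate-unique _≟_ unique))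
                     (LP.filter-all (¬? ∘ (x ≟_)) x∉xs))

length-filter-map : ∀ {A B : Set} {P : Pred A 0ℓ} {Q : Pred B 0ℓ} (P? : Decidable P) (Q? : Decidable Q)
                    (g : B → A) → (∀ x → P (g x) ⇔ Q x) →
                    ∀ xs → length (filter P? (map g xs)) ≡ length (filter Q? xs)
length-filter-map P? Q? g P⇔Q [] = refl
length-filter-map P? Q? g P⇔Q (x ∷ xs) with P? (g x) | Q? x
... | yes _  | yes _  = cong suc (length-filter-map P? Q? g P⇔Q xs)
... | no _   | no _   = length-filter-map P? Q? g P⇔Q xs
... | yes Pₓ | no ¬Qₓ = ⊥-elim (¬Qₓ (Equivalence.to (P⇔Q x) Pₓ))
... | no ¬Pₓ | yes Qₓ = ⊥-elim (¬Pₓ (Equivalence.from (P⇔Q x) Qₓ))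

multiplesBelow : ℕ → ℕ → ℕ
multiplesBelow n M = length (filter (n ℕD.∣?_) (upTo M))

multiplesBelow-suc : ∀ n M → multiplesBelow n (suc M) ≡ multiplesBelow n M ℕ.+ length (filter (n ℕD.∣?_) [ M ])
multiplesBelow-suc n M = begin
  length (filter (n ℕD.∣?_) (upTo (suc M)))                          ≡⟨ cong (length ∘ filter (n ℕD.∣?_)) (LP.upTo-∷ʳ M) ⟨
  length (filter (n ℕD.∣?_) (upTo M ++ [ M ]))                       ≡⟨ cong length (LP.filter-++ (n ℕD.∣?_) (upTo M) [ M ]) ⟩
  length (filter (n ℕD.∣?_) (upTo M) ++ filter (n ℕD.∣?_) [ M ])     ≡⟨ LP.length-++ (filter (n ℕD.∣?_) (upTo M)) ⟩
  multiplesBelow n M ℕ.+ length (filter (n ℕD.∣?_) [ M ])            ∎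
  where open ≡-Reasoning

multiplesBelow-suc-∣ : ∀ {n M} → n ℕD.∣ M → multiplesBelow n (suc M) ≡ suc (multiplesBelow n M)
multiplesBelow-suc-∣ {n} {M} n∣M = trans (multiplesBelow-suc n M)
  (trans (cong (λ xs → multiplesBelow n M ℕ.+ length xs) (LP.filter-accept (n ℕD.∣?_) {xs = []} n∣M))
         (ℕP.+-comm (multiplesBelow n M) 1))

multiplesBelow-suc-∤ : ∀ {n M} → ¬ n ℕD.∣ M → multiplesBelow n (suc M) ≡ multiplesBelow n M
multiplesBelow-suc-∤ {n} {M} n∤M = trans (multiplesBelow-suc n M)
  (trans (cong (λ xs → multiplesBelow n M ℕ.+ length xs) (LP.filter-reject (n ℕD.∣?_) {xs = []} n∤M))
         (ℕP.+-identityʳ (multiplesBelow n M)))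

∣-window : ∀ {n a b} .{{_ : NonZero n}} → n ℕD.∣ a → n ℕD.∣ b → a ≤ b → b < a ℕ.+ n → a ≡ b
∣-window {n} (ℕD.divides p refl) (ℕD.divides q refl) pn≤qn qn<pn+n =
  cong (ℕ._* n) (ℕP.≤-antisym (ℕP.*-cancelʳ-≤ p q n pn≤qn) (ℕP.<⇒≤pred q<1+p))
  where
  q<1+p : q < suc p
  q<1+p = ℕP.*-cancelʳ-< n q (suc p) (subst (q ℕ.* n <_) (ℕP.+-comm (p ℕ.* n) n) qn<pn+n)

multiplesBelow-bounds : ∀ n .{{_ : NonZero n}} M →
                        M ≤ multiplesBelow n M ℕ.* n × multiplesBelow n M ℕ.* n < M ℕ.+ n
multiplesBelow-bounds n zero = z≤n , ℕ.>-nonZero⁻¹ n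
multiplesBelow-bounds n (suc M) with multiplesBelow-bounds n M | n ℕD.∣? M
... | M≤cn , cn<M+n | yes n∣M =
  subst (λ c′ → suc M ≤ c′ ℕ.* n × c′ ℕ.* n < suc M ℕ.+ n) (sym (multiplesBelow-suc-∣ n∣M))
    (subst (λ m → suc M ≤ n ℕ.+ m × n ℕ.+ m < suc M ℕ.+ n) cn≡M
      (ℕP.+-monoˡ-≤ M (ℕ.>-nonZero⁻¹ n) , s≤s (ℕP.≤-reflexive (ℕP.+-comm n M))))
  where
  cn≡M : M ≡ multiplesBelow n M ℕ.* n
  cn≡M = ∣-window n∣M (ℕD.divides (multiplesBelow n M) refl) M≤cn cn<M+n
... | M≤cn , cn<M+n | no n∤M =
  subst (λ c′ → suc M ≤ c′ ℕ.* n × c′ ℕ.* n < suc M ℕ.+ n) (sym (multiplesBelow-suc-∤ n∤M))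
    (ℕP.≤∧≢⇒< M≤cn (λ M≡cn → n∤M (ℕD.divides (multiplesBelow n M) M≡cn)) , ℕP.m<n⇒m<1+n cn<M+n)

-- c/(k+1) − 1/n = e/((k+1)n) with e = cn − (k+1) ∈ [0, n), so the gap is below 1/(k+1) < 1/↧ε ≤ ε.
recip-approx : ∀ {n} .{{_ : NonZero n}} c k (ε : ℚ) → ℚ.Positive ε → ℚ.↧ₙ ε ≤ k →
               suc k ≤ c ℕ.* n → c ℕ.* n < suc k ℕ.+ n →
               ℚ.∣ (+ c) ℚ./ suc k ℚ.- recip n ∣ ℚ.< ε
recip-approx {suc n′} c k ε@(mkℚ +[1+ p ] q _) _ q≤k k<cn cn<k+n =
  subst (ℚ._< ε) (sym (ℚP.0≤p⇒∣p∣≡p 0≤gap)) gap<ε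
  where
  n : ℕ
  n = suc n′
  gap : ℚ
  gap = (+ c) ℚ./ suc k ℚ.- (+ 1) ℚ./ n
  gapᵘ : ℚᵘ
  gapᵘ = mkℚᵘ (+ c) k ℚᵘ.+ ℚᵘ.- mkℚᵘ (+ 1) n′
  gapᵘ≃gap : gapᵘ ℚᵘ.≃ ℚ.toℚᵘ gap
  gapᵘ≃gap = ℚᵘP.≃-sym (ℚᵘP.≃-trans (ℚP.toℚᵘ-homo-+ ((+ c) ℚ./ suc k) (ℚ.- ((+ 1) ℚ./ n)))
               (ℚᵘP.+-cong (ℚP.toℚᵘ-fromℚᵘ (mkℚᵘ (+ c) k))
                 (ℚᵘP.≃-trans (ℚP.toℚᵘ-homo‿- ((+ 1) ℚ./ n)) (ℚᵘP.-‿cong (ℚP.toℚᵘ-fromℚᵘ (mkℚᵘ (+ 1) n′))))))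
  e : ℕ
  e = c ℕ.* n ∸ suc k
  ↥gapᵘ : ℚᵘ.↥ gapᵘ ≡ + e
  ↥gapᵘ = begin
    + c ℤ.* + n ℤ.+ ℤ.- (+ 1) ℤ.* + suc k ≡⟨ cong₂ ℤ._+_ (sym (ℤP.pos-* c n)) (ℤP.*-identityˡ (ℤ.- + suc k)) ⟩
    + (c ℕ.* n) ℤ.- + suc k              ≡⟨ ℤP.m-n≡m⊖n (c ℕ.* n) (suc k) ⟩
    (c ℕ.* n) ℤ.⊖ suc k                  ≡⟨ ℤP.⊖-≥ k<cn ⟩
    + e                                  ∎
    where open ≡-Reasoning
  0≤gap : ℚ.0ℚ ℚ.≤ gap
  0≤gap = ℚP.toℚᵘ-cancel-≤ (ℚᵘP.≤-respʳ-≃ gapᵘ≃gap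
            (*≤* (subst (λ z → ℤ.0ℤ ℤ.≤ z ℤ.* + 1) (sym ↥gapᵘ)
                    (subst (ℤ.0ℤ ℤ.≤_) (sym (ℤP.*-identityʳ (+ e))) (ℤ.+≤+ z≤n)))))
  e<n : e < n
  e<n = ℕP.+-cancelˡ-< (suc k) e n (subst (_< suc k ℕ.+ n) (sym (ℕP.m+[n∸m]≡n k<cn)) cn<k+n)
  cross : e ℕ.* suc q < suc p ℕ.* (suc k ℕ.* n)
  cross = ℕP.≤-<-trans (ℕP.*-monoʳ-≤ e (ℕP.m≤n⇒m≤1+n q≤k))
            (ℕP.<-≤-trans (ℕP.*-monoˡ-< (suc k) e<n)
              (ℕP.≤-trans (ℕP.≤-reflexive (ℕP.*-comm n (suc k))) (ℕP.m≤n*m (suc k ℕ.* n) (suc p))))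
  gap<ε : gap ℚ.< ε
  gap<ε = ℚP.toℚᵘ-cancel-< (ℚᵘP.<-respˡ-≃ gapᵘ≃gap
            (*<* (subst (λ z → z ℤ.* + suc q ℤ.< + suc p ℤ.* + (suc k ℕ.* n)) (sym ↥gapᵘ)
                    (subst₂ ℤ._<_ (ℤP.pos-* e (suc q)) (ℤP.pos-* (suc p) (suc k ℕ.* n)) (ℤ.+<+ cross)))))

module WanderingOrbit {f t B} (escape : EscapeRadius f B) (wandering : Wandering f t) where

  orbit : ℕ → ℤ
  orbit m = iter f m t

  escapeTime : ℕ
  escapeTime = proj₁ (wandering (absBelow B))

  escaped : ∀ {m} → escapeTime ≤ m → B ≤ ∣ orbit m ∣
  escaped {m} e≤m = begin
    B                                               ≤⟨ B≤∣xₑ∣ ⟩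
    ∣ orbit escapeTime ∣                            ≤⟨ ℕP.m≤n+m _ (m ∸ escapeTime) ⟩
    m ∸ escapeTime ℕ.+ ∣ orbit escapeTime ∣         ≤⟨ iter-escapes f escape B≤∣xₑ∣ (m ∸ escapeTime) ⟩
    ∣ iter f (m ∸ escapeTime) (orbit escapeTime) ∣  ≡⟨ cong ∣_∣ (iter-+ f (m ∸ escapeTime) escapeTime t) ⟨
    ∣ orbit (m ∸ escapeTime ℕ.+ escapeTime) ∣       ≡⟨ cong (∣_∣ ∘ orbit) (ℕP.m∸n+n≡m e≤m) ⟩
    ∣ orbit m ∣                                     ∎
    where
    open ℕP.≤-Reasoning
    B≤∣xₑ∣ : B ≤ ∣ orbit escapeTime ∣
    B≤∣xₑ∣ = ℕP.≮⇒≥ (λ small → proj₂ (wandering (absBelow B)) (∈-absBelow _ small))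

  orbit-grows : ∀ {m} → escapeTime ≤ m → ∀ k → k ℕ.+ ∣ orbit m ∣ ≤ ∣ orbit (k ℕ.+ m) ∣
  orbit-grows {m} e≤m k = subst (λ y → k ℕ.+ ∣ orbit m ∣ ≤ ∣ y ∣) (sym (iter-+ f k m t))
                            (iter-escapes f escape (escaped e≤m) k)

  orbit-mono : ∀ {m m′} → escapeTime ≤ m → m ≤ m′ → ∣ orbit m ∣ ≤ ∣ orbit m′ ∣
  orbit-mono {m} {m′} e≤m m≤m′ = subst (λ k → ∣ orbit m ∣ ≤ ∣ orbit k ∣) (ℕP.m∸n+n≡m m≤m′)
    (ℕP.≤-trans (ℕP.m≤n+m _ (m′ ∸ m)) (orbit-grows e≤m (m′ ∸ m)))

  -- A repetition before the escape time propagates to a cycle of the escaped orbit.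
  orbit-<⇒≢ : ∀ {i j} → i < j → orbit i ≢ orbit j
  orbit-<⇒≢ {i} {j} i<j xᵢ≡xⱼ =
    iter-escapes-aperiodic f escape (escaped (ℕP.m≤m+n escapeTime i)) d (begin
      iter f (suc d) (orbit (escapeTime ℕ.+ i)) ≡⟨ iter-+ f (suc d) (escapeTime ℕ.+ i) t ⟨
      orbit (suc d ℕ.+ (escapeTime ℕ.+ i))       ≡⟨ cong orbit (reassoc escapeTime i d) ⟩
      orbit (escapeTime ℕ.+ (suc i ℕ.+ d))       ≡⟨ cong (orbit ∘ (escapeTime ℕ.+_)) (ℕP.m+[n∸m]≡n i<j) ⟩
      orbit (escapeTime ℕ.+ j)                   ≡⟨ iter-+ f escapeTime j t ⟩
      iter f escapeTime (orbit j)                ≡⟨ cong (iter f escapeTime) xᵢ≡xⱼ ⟨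
      iter f escapeTime (orbit i)                ≡⟨ iter-+ f escapeTime i t ⟨
      orbit (escapeTime ℕ.+ i)                   ∎)
    where
    open ≡-Reasoning
    d : ℕ
    d = j ∸ suc i
    reassoc : ∀ e i d → suc d ℕ.+ (e ℕ.+ i) ≡ e ℕ.+ (suc i ℕ.+ d)
    reassoc = ℕSolver.solve-∀

  orbit-injective : ∀ {i j} → orbit i ≡ orbit j → i ≡ j
  orbit-injective {i} {j} xᵢ≡xⱼ with ℕP.<-cmp i j
  ... | tri< i<j _ _ = ⊥-elim (orbit-<⇒≢ i<j xᵢ≡xⱼ)
  ... | tri≈ _ i≡j _ = i≡j
  ... | tri> _ _ j<i = ⊥-elim (orbit-<⇒≢ j<i (sym xᵢ≡xⱼ))

  maxAbsBelow : ℕ → ℕ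
  maxAbsBelow K = ∣ orbit (argmax (λ j → ∣ orbit j ∣) 0 (upTo K)) ∣

  maxAbsBelow-bound : ∀ {j K} → j < K → ∣ orbit j ∣ ≤ maxAbsBelow K
  maxAbsBelow-bound {K = K} j<K = All.lookup (f[xs]≤f[argmax] 0 (upTo K)) (∈-upTo⁺ j<K)

  BoundedBefore : ℕ → ℕ → Set
  BoundedBefore X M = ∀ m → m < M → ∣ orbit m ∣ ≤ X

  LeavesAt : ℕ → ℕ → Set
  LeavesAt X M = BoundedBefore X M × Cutoff f t X M

  leavesAt-exists : ∀ {K X} → escapeTime ≤ K → maxAbsBelow K ≤ X → ∃ λ M → K ≤ M × LeavesAt X M
  leavesAt-exists {K} {X} e≤K max≤X with first-from (λ m → X ℕ.<? ∣ orbit m ∣) K inside (suc X) outside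
    where
    inside : ∀ j → j < K → ¬ X < ∣ orbit j ∣
    inside j j<K = ℕP.≤⇒≯ (ℕP.≤-trans (maxAbsBelow-bound j<K) max≤X)
    outside : X < ∣ orbit (suc X ℕ.+ K) ∣
    outside = ℕP.≤-trans (s≤s (ℕP.m≤m+n X _)) (orbit-grows e≤K (suc X))
  ... | M , K≤M , X<∣xₘ∣ , earlier =
    M , K≤M , (λ m m<M → ℕP.≮⇒≥ (earlier m m<M)) ,
    λ m M≤m → ℕP.<-≤-trans X<∣xₘ∣ (orbit-mono (ℕP.≤-trans e≤K K≤M) M≤m)

  orbBelow≡filter : ∀ {P X M} (P? : Decidable P) → BoundedBefore X M →
                    orbBelow f t P P? X M ≡ filter P? (map orbit (upTo M))
  orbBelow≡filter {X = X} {M} P? inside = begin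
    deduplicate ℤ._≟_ (filter P? (filter (λ x → ∣ x ∣ ℕ.≤? X) (map orbit (upTo M))))
      ≡⟨ cong (deduplicate ℤ._≟_ ∘ filter P?) (LP.filter-all (λ x → ∣ x ∣ ℕ.≤? X) (All.tabulate small)) ⟩
    deduplicate ℤ._≟_ (filter P? (map orbit (upTo M)))
      ≡⟨ deduplicate-unique ℤ._≟_ (UP.filter⁺ P? (UP.map⁺ orbit-injective (UP.upTo⁺ M))) ⟩
    filter P? (map orbit (upTo M)) ∎
    where
    open ≡-Reasoning
    small : ∀ {x} → x ∈ map orbit (upTo M) → ∣ x ∣ ≤ X
    small x∈ with ∈-map⁻ orbit x∈
    ... | m , m∈ , refl = inside m (∈-upTo⁻ m∈)

  orbBelow-length : ∀ {X M} → BoundedBefore X M → length (orbBelow f t Univ Univ? X M) ≡ M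
  orbBelow-length {X} {M} inside = begin
    length (orbBelow f t Univ Univ? X M)       ≡⟨ cong length (orbBelow≡filter Univ? inside) ⟩
    length (filter Univ? (map orbit (upTo M))) ≡⟨ cong length (LP.filter-all Univ? {xs = map orbit (upTo M)} (All.universal _ _)) ⟩
    length (map orbit (upTo M))                ≡⟨ LP.length-map orbit (upTo M) ⟩
    length (upTo M)                            ≡⟨ LP.length-upTo M ⟩
    M                                          ∎
    where open ≡-Reasoning

  orbBelow-length-multiples : ∀ {A} (A? : Decidable A) n → (∀ m → A (orbit m) ⇔ n ℕD.∣ m) →
                              ∀ {X M} → BoundedBefore X M →
                              length (orbBelow f t A A? X M) ≡ multiplesBelow n M
  orbBelow-length-multiples A? n A⇔n∣ {M = M} inside =
    trans (cong length (orbBelow≡filter A? inside)) (length-filter-map A? (n ℕD.∣?_) orbit A⇔n∣ (upTo M))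

  density-index-multiples : ∀ {A} (A? : Decidable A) n .{{_ : NonZero n}} →
                            (∀ m → A (orbit m) ⇔ n ℕD.∣ m) → DensityIs f t A A? (recip n)
  density-index-multiples {A} A? n A⇔n∣ ε ε>0 =
    maxAbsBelow K , λ X max≤X → estimate X (leavesAt-exists (ℕP.m≤n+m escapeTime (suc (ℚ.↧ₙ ε))) max≤X)
    where
    K : ℕ
    K = suc (ℚ.↧ₙ ε) ℕ.+ escapeTime
    estimate : ∀ X → ∃ (λ M → K ≤ M × LeavesAt X M) → Σ ℕ λ N → Cutoff f t X N × Σ ℕ λ k →
               (length (orbBelow f t Univ Univ? X N) ≡ suc k) ×
               (ℚ.∣ (+ length (orbBelow f t A A? X N)) ℚ./ suc k ℚ.- recip n ∣ ℚ.< ε)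
    estimate X (zero , () , _)
    estimate X (suc k , K≤1+k , inside , outside) =
      suc k , outside , k , orbBelow-length inside ,
      subst (λ c → ℚ.∣ (+ c) ℚ./ suc k ℚ.- recip n ∣ ℚ.< ε) (sym (orbBelow-length-multiples A? n A⇔n∣ inside))
        (recip-approx (multiplesBelow n (suc k)) k ε ε>0 ↧ε≤k lower upper)
      where
      ↧ε≤k : ℚ.↧ₙ ε ≤ k
      ↧ε≤k = ℕP.≤-pred (ℕP.≤-trans (ℕP.m≤m+n _ escapeTime) K≤1+k)
      lower : suc k ≤ multiplesBelow n (suc k) ℕ.* n
      lower = proj₁ (multiplesBelow-bounds n (suc k))
      upper : multiplesBelow n (suc k) ℕ.* n < suc k ℕ.+ n
      upper = proj₂ (multiplesBelow-bounds n (suc k))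

corollary6p4 : (f : Poly) (d : ℕ) (t : ℤ) → HasDegree f d → 2 ≤ d →
    Wandering f t → (n : ℕ) → InS f t n → Accessible f t 1 (recip n)
corollary6p4 f d t deg 2≤d wandering (suc n′) (_ , u , pd@(+2≤u , _)) =
  (λ _ → ∣ u ∣) , (λ _ → 1≤∣u∣ +2≤u) ,
  WanderingOrbit.density-index-multiples escape wandering (InUnionAP? t _) (suc n′) criterion
  where
  escape : EscapeRadius f (proj₁ (degree≥2⇒escapeRadius deg 2≤d))
  escape = proj₂ (degree≥2⇒escapeRadius deg 2≤d)
  1≤∣u∣ : ∀ {u} → + 2 ℤ.≤ u → 1 ≤ ∣ u ∣
  1≤∣u∣ (ℤ.+≤+ 2≤m) = ℕP.≤-trans (s≤s z≤n) 2≤m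
  criterion : ∀ m → InUnionAP t (λ _ → ∣ u ∣) (iter f m t) ⇔ suc n′ ℕD.∣ m
  criterion m = mk⇔ (λ (_ , u∣) → Equivalence.to (primitiveDivisor-∣⇔∣ pd m) u∣)
                    (λ n∣m → Fin.zero , Equivalence.from (primitiveDivisor-∣⇔∣ pd m) n∣m)
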